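{- Every Steiner triple system of order $n$ with $n\geq 7$ can be embedded into a partial $3$-sun system of order $\frac{3n-1}{2}$.
   Context: All graphs are simple and finite. A Steiner triple system of order $n$ is a pair $(X,\mathcal{T})$ with $|X|=n$ and $\mathcal{T}$ a collection of triangles whose edge sets partition the edges of the complete graph on $X$. A $3$-sun is the graph on six vertices consisting of a triangle $\{a,b,c\}$ with three pendant edges $\{a,d\},\{b,e\},\{c,f\}$. A partial $3$-sun system of order $m$ is a pair $(V,\mathcal{S})$ with $|V|=m$ and $\mathcal{S}$ a collection of subgraphs of the complete graph $K_m$ on $V$, each isomorphic to a $3$-sun, whose edge sets are pairwise disjoint and partition the edge set of a proper spanning subgraph of $K_m$. An STS $(X,\mathcal{T})$ is embedded into a (partial) $3$-sun system $(X\cup U,\mathcal{S})$ with $X\cap U=\emptyset$ if there is an injective map $f:\mathcal{T}\to\mathcal{S}$ such that $T$ is a subgraph of $f(T)$ for every $T\in\mathcal{T}$. -}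

module Defs where

open import Data.Nat using (ℕ; _*_; _∸_; _≤_)
open import Data.Nat.DivMod using (_/_)
open import Data.Fin using (Fin; zero; suc)
open import Data.Product using (Σ; _×_; _,_; ∃)
open import Data.Sum using (_⊎_)
open import Relation.Binary.PropositionalEquality using (_≡_; _≢_)
open import Relation.Nullary using (¬_)
open import Function.Definitions using (Injective)

-- The complete graph K_k has vertex set Fin k; an (undirected) edge {x,y}
-- is given by two distinct vertices, read unordered.

SameEdge : {k : ℕ} → Fin k → Fin k → Fin k → Fin k → Set
SameEdge x y u v = (x ≡ u × y ≡ v) ⊎ (x ≡ v × y ≡ u)

record Triangle (k : ℕ) : Set where
  constructor tri
  field
    a b c : Fin k
    a≢b : a ≢ b
    b≢c : b ≢ c
    a≢c : a ≢ c
open Triangle public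

TriEdge : {k : ℕ} → Triangle k → Fin k → Fin k → Set
TriEdge t x y = SameEdge x y (a t) (b t) ⊎ SameEdge x y (b t) (c t) ⊎ SameEdge x y (a t) (c t)

IsSTS : (n t : ℕ) → (Fin t → Triangle n) → Set
IsSTS n t T = (x y : Fin n) → x ≢ y →
  Σ (Fin t) λ i → TriEdge (T i) x y × ((j : Fin t) → TriEdge (T j) x y → j ≡ i)

-- A 3-sun in K_m: six distinct vertices v0..v5 with triangle {v0,v1,v2}
-- and pendant edges {v0,v3}, {v1,v4}, {v2,v5}.
record Sun (m : ℕ) : Set where
  constructor sun
  field
    v : Fin 6 → Fin m
    v-inj : Injective _≡_ _≡_ v
open Sun public

v0 v1 v2 v3 v4 v5 : Fin 6
v0 = zero
v1 = suc zero
v2 = suc (suc zero)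
v3 = suc (suc (suc zero))
v4 = suc (suc (suc (suc zero)))
v5 = suc (suc (suc (suc (suc zero))))

SunEdge : {m : ℕ} → Sun m → Fin m → Fin m → Set
SunEdge S x y =
  SameEdge x y (v S v0) (v S v1) ⊎ SameEdge x y (v S v1) (v S v2) ⊎
  SameEdge x y (v S v2) (v S v0) ⊎ SameEdge x y (v S v0) (v S v3) ⊎
  SameEdge x y (v S v1) (v S v4) ⊎ SameEdge x y (v S v2) (v S v5)

-- Partial 3-sun system of order m: a collection of s 3-suns of K_m with
-- pairwise edge-disjoint edge sets, whose union is a proper spanning
-- subgraph of K_m (i.e. some edge of K_m is not covered).
IsPartialSunSystem : (m s : ℕ) → (Fin s → Sun m) → Set
IsPartialSunSystem m s S =
  ((i j : Fin s) → i ≢ j → (x y : Fin m) → SunEdge (S i) x y → ¬ SunEdge (S j) x y)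
  × Σ (Fin m) λ x → Σ (Fin m) λ y → x ≢ y × ((i : Fin s) → ¬ SunEdge (S i) x y)

TriangleInSun : {n m : ℕ} → (Fin n → Fin m) → Triangle n → Sun m → Set
TriangleInSun g t S =
  SunEdge S (g (a t)) (g (b t)) × SunEdge S (g (b t)) (g (c t)) × SunEdge S (g (a t)) (g (c t))

-- STS (X = Fin n, T) embeds into the partial 3-sun system (V = Fin m, S),
-- where X is identified with a subset of V via an injective map g
-- (V = X ∪ U with U the complement of the image):
-- there is an injective f : T → S with T a subgraph of f(T).
EmbedsInto : (n t m s : ℕ) → (Fin n → Fin m) → (Fin t → Triangle n) → (Fin s → Sun m) → Set
EmbedsInto n t m s g T S =
  Σ (Fin t → Fin s) λ f → Injective _≡_ _≡_ f × ((i : Fin t) → TriangleInSun g (T i) (S (f i)))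

-- Put r = (n - 1)/2, so that (3n - 1)/2 = n + r. The flags (triangle, corner)
-- of the STS form a bipartite graph between triangles and points in which a
-- triangle has degree 3 and a point degree at most r, because the triangles
-- through a point w partition the other n - 1 points into pairs. By König's
-- edge-colouring theorem the flags can be coloured with r colours so that the
-- three corners of a triangle get distinct colours and so do the flags through
-- a point. Adding r new vertices u_γ, triangle {a, b, c} becomes the 3-sun with
-- pendant edges a u_γ(a), b u_γ(b), c u_γ(c); pendant edges of different suns
-- differ because colours at a point are distinct, and no edge u_γ u_δ is used.
module Submission where

open import Defs
open import Data.Nat using (ℕ; zero; suc; _+_; _*_; _∸_; _≤_; _<_; s≤s)
open import Data.Nat.Properties using (≤⇒≯; +-comm; +-monoˡ-<; module ≤-Reasoning)
open import Data.Nat.DivMod using (_/_; _%_; m≡m%n+[m/n]*n; m%n<n; m*n/n≡m; +-distrib-/-∣ʳ; /-monoˡ-≤)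
open import Data.Nat.Divisibility using (divides-refl)
open import Data.Nat.Tactic.RingSolver using (solve-∀)
open import Data.Fin using (Fin; zero; suc; punchIn; punchOut; _↑ˡ_; _↑ʳ_; splitAt; join; combine; remQuot; quotient; remainder; _≟_)
open import Data.Fin.Properties using (any?; all?; ¬∀⟶∃¬; injective⇒≤; suc-injective; punchIn-injective; punchInᵢ≢i; punchIn-punchOut; punchOut-injective; ↑ˡ-injective; ↑ʳ-injective; splitAt-↑ˡ; splitAt-↑ʳ; join-splitAt; combine-remQuot; remQuot-combine; combine-injectiveˡ; combine-injectiveʳ)
open import Data.Vec.Functional using (insertAt; _++_)
open import Data.Vec.Functional.Properties using (insertAt-lookup; insertAt-punchIn)
open import Data.Product using (Σ; _×_; _,_; ∃; proj₁; proj₂; uncurry)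
open import Data.Sum using (_⊎_; inj₁; inj₂; [_,_]′; swap)
open import Data.Empty using (⊥-elim)
open import Relation.Nullary using (¬_; Dec; yes; no)
open import Relation.Nullary.Decidable using (_×-dec_)
open import Function using (_∘_; id)
open import Function.Definitions using (Injective)
open import Relation.Binary.PropositionalEquality using (_≡_; _≢_; refl; sym; trans; cong; cong₂; subst; subst₂; module ≡-Reasoning)

-- A bipartite multigraph with edge set Fin e is given by its two endpoint
-- maps F and G; an edge colouring is proper when it is ProperAt F and at G.

ProperAt : ∀ {e} {V C : Set} → (Fin e → V) → (Fin e → C) → Set
ProperAt f col = ∀ {x y} → f x ≡ f y → col x ≡ col y → x ≡ y

Free : ∀ {e} {V C : Set} → (Fin e → V) → (Fin e → C) → V → C → Set
Free f col v γ = ∀ x → f x ≡ v → col x ≢ γ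

DegreeAtMost : ∀ {e} {V : Set} → ℕ → (Fin e → V) → Set
DegreeAtMost r f = ∀ v (h : Fin (suc r) → Fin _) → Injective _≡_ _≡_ h → ¬ (∀ i → f (h i) ≡ v)

OneOf : ∀ {C : Set} → C → C → C → Set
OneOf α β γ = γ ≡ α ⊎ γ ≡ β

ProperAt-∘ : ∀ {d e} {V C : Set} {f : Fin e → V} {col : Fin e → C} {ι : Fin d → Fin e} →
             Injective _≡_ _≡_ ι → ProperAt f col → ProperAt (f ∘ ι) (col ∘ ι)
ProperAt-∘ ι-inj proper fx cx = ι-inj (proper fx cx)

DegreeAtMost-∘ : ∀ {d e r} {V : Set} {f : Fin e → V} {ι : Fin d → Fin e} →
                 Injective _≡_ _≡_ ι → DegreeAtMost r f → DegreeAtMost r (f ∘ ι)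
DegreeAtMost-∘ {ι = ι} ι-inj deg v h h-inj = deg v (ι ∘ h) (h-inj ∘ ι-inj)

ProperAt⇒DegreeAtMost : ∀ {e k r} {V : Set} {f : Fin e → V} {col : Fin e → Fin k} →
                        ProperAt f col → k ≤ r → DegreeAtMost r f
ProperAt⇒DegreeAtMost {col = col} proper k≤r v h h-inj at-v =
  ≤⇒≯ k≤r (injective⇒≤ {f = col ∘ h} λ eq → h-inj (proper (trans (at-v _) (sym (at-v _))) eq))

removed-colour-free : ∀ {e} {V C : Set} {f : Fin (suc e) → V} {col : Fin (suc e) → C} →
                      ProperAt f col → ∀ i → Free (f ∘ punchIn i) (col ∘ punchIn i) (f i) (col i)
removed-colour-free proper i j fj cj = punchInᵢ≢i i j (proper fj cj)

free-colour : ∀ {e a r} (f : Fin (suc e) → Fin a) (col : Fin e → Fin r) →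
              DegreeAtMost r f → ∃ (Free (f ∘ suc) col (f zero))
free-colour {e} {r = r} f col deg = choose (all? used?)
  where
    Used : Fin r → Set
    Used γ = ∃ λ x → f (suc x) ≡ f zero × col x ≡ γ

    used? : ∀ γ → Dec (Used γ)
    used? γ = any? (λ x → (f (suc x) ≟ f zero) ×-dec (col x ≟ γ))

    choose : Dec (∀ γ → Used γ) → ∃ (Free (f ∘ suc) col (f zero))
    choose (no ¬all-used) =
      let (γ , unused) = ¬∀⟶∃¬ r Used used? ¬all-used in γ , λ x fx cx → unused (x , fx , cx)
    choose (yes used) = ⊥-elim (deg (f zero) h h-injective h-at-f₀)
      where
        h : Fin (suc r) → Fin (suc e)
        h zero = zero
        h (suc γ) = suc (proj₁ (used γ))

        h-injective : Injective _≡_ _≡_ h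
        h-injective {zero} {zero} _ = refl
        h-injective {suc γ} {suc δ} eq =
          cong suc (trans (sym (proj₂ (proj₂ (used γ)))) (trans (cong col (suc-injective eq)) (proj₂ (proj₂ (used δ)))))

        h-at-f₀ : ∀ i → f (h i) ≡ f zero
        h-at-f₀ zero = refl
        h-at-f₀ (suc γ) = proj₁ (proj₂ (used γ))

data PunchInView {n} (i : Fin (suc n)) : Fin (suc n) → Set where
  at : PunchInView i i
  punched : ∀ j → PunchInView i (punchIn i j)

punchInView : ∀ {n} (i x : Fin (suc n)) → PunchInView i x
punchInView i x with i ≟ x
... | yes refl = at
... | no i≢x = subst (PunchInView i) (punchIn-punchOut i≢x) (punched (punchOut i≢x))

ProperAt-insertAt : ∀ {e} {V C : Set} {f : Fin (suc e) → V} {col : Fin e → C} {i γ} →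
                    ProperAt (f ∘ punchIn i) col → Free (f ∘ punchIn i) col (f i) γ →
                    ProperAt f (insertAt col i γ)
ProperAt-insertAt {f = f} {col} {i} {γ} proper free {x} {y} fx cx = go (punchInView i x) (punchInView i y) fx cx
  where
    lookup-at : insertAt col i γ i ≡ γ
    lookup-at = insertAt-lookup col i γ

    lookup-punched : ∀ j → insertAt col i γ (punchIn i j) ≡ col j
    lookup-punched = insertAt-punchIn col i γ

    go : ∀ {x y} → PunchInView i x → PunchInView i y →
         f x ≡ f y → insertAt col i γ x ≡ insertAt col i γ y → x ≡ y
    go at at _ _ = refl
    go at (punched j) fx cx = ⊥-elim (free j (sym fx) (trans (sym (lookup-punched j)) (trans (sym cx) lookup-at)))
    go (punched j) at fx cx = ⊥-elim (free j fx (trans (sym (lookup-punched j)) (trans cx lookup-at)))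
    go (punched j) (punched k) fx cx =
      cong (punchIn i) (proper fx (trans (sym (lookup-punched j)) (trans cx (lookup-punched k))))

Free-insertAt : ∀ {e} {V C : Set} {f : Fin (suc e) → V} {col : Fin e → C} {i γ v δ} →
                (f i ≡ v → γ ≢ δ) → Free (f ∘ punchIn i) col v δ → Free f (insertAt col i γ) v δ
Free-insertAt {f = f} {col} {i} {γ} {v} {δ} new-differs free x = go (punchInView i x)
  where
    go : ∀ {x} → PunchInView i x → f x ≡ v → insertAt col i γ x ≢ δ
    go at fx cx = new-differs fx (trans (sym (insertAt-lookup col i γ)) cx)
    go (punched j) fx cx = free j fx (trans (sym (insertAt-punchIn col i γ j)) cx)

-- The recolouring of col produced by interchanging α and β along the
-- alternating α/β-path that starts at v.
record KempeRecolouring {e a b r} (F : Fin e → Fin a) (G : Fin e → Fin b) (col : Fin e → Fin r)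
                        (v : Fin a) (α β : Fin r) : Set where
  field
    colour      : Fin e → Fin r
    properF     : ProperAt F colour
    properG     : ProperAt G colour
    α-free-at-v : Free F colour v α
    keeps-α-free : ∀ w → Free G col w α → Free G colour w α
    keeps-β-free : ∀ u → u ≢ v → Free F col u β → Free F colour u β
    only-swaps  : ∀ x → OneOf α β (colour x) → OneOf α β (col x)

unchanged : ∀ {e a b r} {F : Fin e → Fin a} {G : Fin e → Fin b} {col : Fin e → Fin r} {v α β} →
            ProperAt F col → ProperAt G col → Free F col v α → KempeRecolouring F G col v α β
unchanged {col = col} properF properG α-free = record
  { colour = col ; properF = properF ; properG = properG ; α-free-at-v = α-free
  ; keeps-α-free = λ _ → id ; keeps-β-free = λ _ _ → id ; only-swaps = λ _ → id }

-- With x₀ the α-edge at v: recolour the graph without x₀ so as to free β at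
-- G x₀, where the path continues with the roles of α and β exchanged, then
-- give x₀ the colour β.
kempe-extend : ∀ {e a b r} (F : Fin (suc e) → Fin a) (G : Fin (suc e) → Fin b) {col : Fin (suc e) → Fin r} {β} →
               ProperAt F col → (x₀ : Fin (suc e)) → Free F col (F x₀) β →
               KempeRecolouring (G ∘ punchIn x₀) (F ∘ punchIn x₀) (col ∘ punchIn x₀) (G x₀) β (col x₀) →
               KempeRecolouring F G col (F x₀) (col x₀) β
kempe-extend F G {col} {β} properF x₀ β-free rest = record
  { colour = insertAt R.colour x₀ β
  ; properF = ProperAt-insertAt R.properG (R.keeps-α-free (F x₀) (β-free ∘ punchIn x₀))
  ; properG = ProperAt-insertAt R.properF R.α-free-at-v
  ; α-free-at-v = Free-insertAt (λ _ → β≢α) α-free-after-removal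
  ; keeps-α-free = λ w α-free → Free-insertAt (λ _ → β≢α)
      (R.keeps-β-free w (λ w≡w₁ → α-free x₀ (sym w≡w₁) refl) (α-free ∘ punchIn x₀))
  ; keeps-β-free = λ u u≢v β-free-at-u → Free-insertAt (λ v≡u → ⊥-elim (u≢v (sym v≡u)))
      (R.keeps-α-free u (β-free-at-u ∘ punchIn x₀))
  ; only-swaps = λ x → only-swaps (punchInView x₀ x)
  }
  where
    module R = KempeRecolouring rest
    α = col x₀

    β≢α : β ≢ α
    β≢α β≡α = β-free x₀ refl (sym β≡α)

    α-free-after-removal : Free (F ∘ punchIn x₀) R.colour (F x₀) α
    α-free-after-removal j Fj cj with R.only-swaps j (inj₂ cj)
    ... | inj₁ was-β = β-free (punchIn x₀ j) Fj was-β
    ... | inj₂ was-α = punchInᵢ≢i x₀ j (properF Fj was-α)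

    only-swaps : ∀ {x} → PunchInView x₀ x → OneOf α β (insertAt R.colour x₀ β x) → OneOf α β (col x)
    only-swaps at _ = inj₁ refl
    only-swaps (punched j) c =
      swap (R.only-swaps j (swap (subst (OneOf α β) (insertAt-punchIn R.colour x₀ β j) c)))

kempe : ∀ {e a b r} (F : Fin e → Fin a) (G : Fin e → Fin b) {col : Fin e → Fin r} →
        ProperAt F col → ProperAt G col → ∀ {α β} v → Free F col v β → KempeRecolouring F G col v α β
kempe {zero} F G properF properG v _ = unchanged properF properG λ ()
kempe {suc e} F G {col} properF properG {α} v β-free with any? (λ x → (F x ≟ v) ×-dec (col x ≟ α))
... | no no-α-edge = unchanged properF properG λ x Fx cx → no-α-edge (x , Fx , cx)
... | yes (x₀ , refl , refl) = kempe-extend F G properF x₀ β-free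
  (kempe (G ∘ punchIn x₀) (F ∘ punchIn x₀) (ProperAt-∘ (punchIn-injective x₀ _ _) properG)
    (ProperAt-∘ (punchIn-injective x₀ _ _) properF) (G x₀) (removed-colour-free properG x₀))

bipartite-edge-colouring : ∀ {e a b r} (L : Fin e → Fin a) (R : Fin e → Fin b) →
                           DegreeAtMost r L → DegreeAtMost r R →
                           ∃ λ (col : Fin e → Fin r) → ProperAt L col × ProperAt R col
bipartite-edge-colouring {zero} L R _ _ = (λ ()) , (λ { {()} }) , (λ { {()} })
bipartite-edge-colouring {suc e} L R degL degR =
  let (col , properL , properR) = bipartite-edge-colouring (L ∘ suc) (R ∘ suc)
        (DegreeAtMost-∘ {f = L} suc-injective degL) (DegreeAtMost-∘ {f = R} suc-injective degR)
      (β , β-free) = free-colour L col degL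
      (α , α-free) = free-colour R col degR
      open KempeRecolouring (kempe (L ∘ suc) (R ∘ suc) properL properR {α} (L zero) β-free)
  in insertAt colour zero α , ProperAt-insertAt properF α-free-at-v ,
     ProperAt-insertAt properG (keeps-α-free (R zero) α-free)

remQuot-injective : ∀ {m} k → Injective _≡_ _≡_ (remQuot {m} k)
remQuot-injective {m} k {x} {y} eq =
  trans (sym (combine-remQuot {m} k x)) (trans (cong (uncurry combine) eq) (combine-remQuot {m} k y))

injective-avoiding⇒< : ∀ {m n} {f : Fin m → Fin n} → Injective _≡_ _≡_ f → (w : Fin n) → (∀ i → w ≢ f i) → m < n
injective-avoiding⇒< {n = suc n} f-inj w avoids = s≤s (injective⇒≤ λ eq → f-inj (punchOut-injective (avoids _) (avoids _) eq))

++-injective : ∀ {k l m} {xs : Fin k → Fin m} {ys : Fin l → Fin m} →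
               Injective _≡_ _≡_ xs → Injective _≡_ _≡_ ys → (∀ p q → xs p ≢ ys q) →
               Injective _≡_ _≡_ (xs ++ ys)
++-injective {k} {l} {xs = xs} {ys} xs-inj ys-inj disjoint {x} {y} eq =
  trans (sym (join-splitAt k l x)) (trans (cong (join k l) (sides (splitAt k x) (splitAt k y) eq)) (join-splitAt k l y))
  where
    sides : ∀ s s′ → [ xs , ys ]′ s ≡ [ xs , ys ]′ s′ → s ≡ s′
    sides (inj₁ p) (inj₁ q) eq = cong inj₁ (xs-inj eq)
    sides (inj₁ p) (inj₂ q) eq = ⊥-elim (disjoint p q eq)
    sides (inj₂ p) (inj₁ q) eq = ⊥-elim (disjoint q p (sym eq))
    sides (inj₂ p) (inj₂ q) eq = cong inj₂ (ys-inj eq)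

vertex : ∀ {n} → Triangle n → Fin 3 → Fin n
vertex τ zero = a τ
vertex τ (suc zero) = b τ
vertex τ (suc (suc zero)) = c τ

vertex-injective : ∀ {n} (τ : Triangle n) → Injective _≡_ _≡_ (vertex τ)
vertex-injective τ {zero} {zero} _ = refl
vertex-injective τ {zero} {suc zero} eq = ⊥-elim (a≢b τ eq)
vertex-injective τ {zero} {suc (suc zero)} eq = ⊥-elim (a≢c τ eq)
vertex-injective τ {suc zero} {zero} eq = ⊥-elim (a≢b τ (sym eq))
vertex-injective τ {suc zero} {suc zero} _ = refl
vertex-injective τ {suc zero} {suc (suc zero)} eq = ⊥-elim (b≢c τ eq)
vertex-injective τ {suc (suc zero)} {zero} eq = ⊥-elim (a≢c τ (sym eq))
vertex-injective τ {suc (suc zero)} {suc zero} eq = ⊥-elim (b≢c τ (sym eq))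
vertex-injective τ {suc (suc zero)} {suc (suc zero)} _ = refl

vertex-TriEdge : ∀ {n} (τ : Triangle n) {p q} → p ≢ q → TriEdge τ (vertex τ p) (vertex τ q)
vertex-TriEdge τ {zero} {zero} p≢q = ⊥-elim (p≢q refl)
vertex-TriEdge τ {zero} {suc zero} _ = inj₁ (inj₁ (refl , refl))
vertex-TriEdge τ {zero} {suc (suc zero)} _ = inj₂ (inj₂ (inj₁ (refl , refl)))
vertex-TriEdge τ {suc zero} {zero} _ = inj₁ (inj₂ (refl , refl))
vertex-TriEdge τ {suc zero} {suc zero} p≢q = ⊥-elim (p≢q refl)
vertex-TriEdge τ {suc zero} {suc (suc zero)} _ = inj₂ (inj₁ (inj₁ (refl , refl)))
vertex-TriEdge τ {suc (suc zero)} {zero} _ = inj₂ (inj₂ (inj₂ (refl , refl)))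
vertex-TriEdge τ {suc (suc zero)} {suc zero} _ = inj₂ (inj₁ (inj₂ (refl , refl)))
vertex-TriEdge τ {suc (suc zero)} {suc (suc zero)} p≢q = ⊥-elim (p≢q refl)

IsSTS-unique : ∀ {n t} (T : Fin t → Triangle n) → IsSTS n t T → ∀ {x y i j} → x ≢ y → TriEdge (T i) x y → TriEdge (T j) x y → i ≡ j
IsSTS-unique T sts {x} {y} {i} {j} x≢y in-i in-j = let (_ , _ , unique) = sts x y x≢y in trans (unique i in-i) (sym (unique j in-j))

data SunEdgeView {m} (xs ys : Fin 3 → Fin m) (x y : Fin m) : Set where
  triangle : ∀ p q → p ≢ q → x ≡ xs p → y ≡ xs q → SunEdgeView xs ys x y
  pendant  : ∀ p → SameEdge x y (xs p) (ys p) → SunEdgeView xs ys x y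

sunEdgeView : ∀ {m} {xs ys : Fin 3 → Fin m} (inj : Injective _≡_ _≡_ (xs ++ ys)) {x y} →
              SunEdge (sun (xs ++ ys) inj) x y → SunEdgeView xs ys x y
sunEdgeView _ (inj₁ (inj₁ (x≡ , y≡))) = triangle zero (suc zero) (λ ()) x≡ y≡
sunEdgeView _ (inj₁ (inj₂ (x≡ , y≡))) = triangle (suc zero) zero (λ ()) x≡ y≡
sunEdgeView _ (inj₂ (inj₁ (inj₁ (x≡ , y≡)))) = triangle (suc zero) (suc (suc zero)) (λ ()) x≡ y≡
sunEdgeView _ (inj₂ (inj₁ (inj₂ (x≡ , y≡)))) = triangle (suc (suc zero)) (suc zero) (λ ()) x≡ y≡
sunEdgeView _ (inj₂ (inj₂ (inj₁ (inj₁ (x≡ , y≡))))) = triangle (suc (suc zero)) zero (λ ()) x≡ y≡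
sunEdgeView _ (inj₂ (inj₂ (inj₁ (inj₂ (x≡ , y≡))))) = triangle zero (suc (suc zero)) (λ ()) x≡ y≡
sunEdgeView _ (inj₂ (inj₂ (inj₂ (inj₁ e)))) = pendant zero e
sunEdgeView _ (inj₂ (inj₂ (inj₂ (inj₂ (inj₁ e))))) = pendant (suc zero) e
sunEdgeView _ (inj₂ (inj₂ (inj₂ (inj₂ (inj₂ e))))) = pendant (suc (suc zero)) e

EmbedsInPartialSunSystem : (n t : ℕ) → (Fin t → Triangle n) → ℕ → Set
EmbedsInPartialSunSystem n t T m =
  Σ (Fin n → Fin m) λ g → Injective _≡_ _≡_ g ×
    Σ ℕ λ s → Σ (Fin s → Sun m) λ S → IsPartialSunSystem m s S × EmbedsInto n t m s g T S

-- A flag is a pair (triangle, corner), encoded in Fin (t * 3).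
module Flags {n t : ℕ} (T : Fin t → Triangle n) where

  flagTriangle : Fin (t * 3) → Fin t
  flagTriangle = quotient 3

  flagCorner : Fin (t * 3) → Fin 3
  flagCorner = remainder {t} 3

  flagPoint : Fin (t * 3) → Fin n
  flagPoint ι = vertex (T (flagTriangle ι)) (flagCorner ι)

  flagTriangle-combine : ∀ i p → flagTriangle (combine i p) ≡ i
  flagTriangle-combine i p = cong proj₁ (remQuot-combine i p)

  flagPoint-combine : ∀ i p → flagPoint (combine i p) ≡ vertex (T i) p
  flagPoint-combine i p = cong (λ (i , p) → vertex (T i) p) (remQuot-combine i p)

  flag-determined-by-corner : ProperAt flagTriangle flagCorner
  flag-determined-by-corner same-triangle same-corner = remQuot-injective 3 (cong₂ _,_ same-triangle same-corner)

  flag-determined-by-point : ProperAt flagTriangle flagPoint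
  flag-determined-by-point {ι} {κ} same-triangle same-point = flag-determined-by-corner same-triangle
    (vertex-injective (T (flagTriangle ι))
      (trans same-point (cong (λ i → vertex (T i) (flagCorner κ)) (sym same-triangle))))

  flagTriangle-degree : ∀ {r} → 3 ≤ r → DegreeAtMost r flagTriangle
  flagTriangle-degree = ProperAt⇒DegreeAtMost flag-determined-by-corner

  -- The two other corners of the r + 1 triangles through w would be
  -- 2(r + 1) distinct points different from w.
  flagPoint-degree : IsSTS n t T → ∀ {r} → n ≤ suc r * 2 → DegreeAtMost r flagPoint
  flagPoint-degree sts {r} n≤ w h h-inj at-w =
    ≤⇒≯ n≤ (injective-avoiding⇒< (remQuot-injective {suc r} 2 ∘ neighbour-injective) w (λ k → w≢neighbour (remQuot 2 k)))
    where
      triangleOf : Fin (suc r) → Triangle n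
      triangleOf j = T (flagTriangle (h j))

      corner : Fin (suc r) → Fin 3
      corner j = flagCorner (h j)

      neighbour : Fin (suc r) × Fin 2 → Fin n
      neighbour (j , s) = vertex (triangleOf j) (punchIn (corner j) s)

      w≢neighbour : ∀ q → w ≢ neighbour q
      w≢neighbour (j , s) eq =
        punchInᵢ≢i (corner j) s (sym (vertex-injective (triangleOf j) (trans (at-w j) eq)))

      edge-to-neighbour : ∀ q → TriEdge (triangleOf (proj₁ q)) w (neighbour q)
      edge-to-neighbour (j , s) = subst (λ x → TriEdge (triangleOf j) x (neighbour (j , s))) (at-w j)
        (vertex-TriEdge (triangleOf j) (punchInᵢ≢i (corner j) s ∘ sym))

      neighbour-injective : Injective _≡_ _≡_ neighbour
      neighbour-injective {j , s} {k , s′} eq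
        with refl ← h-inj (flag-determined-by-point
               (IsSTS-unique T sts {i = flagTriangle (h j)} {j = flagTriangle (h k)} (w≢neighbour (j , s)) (edge-to-neighbour (j , s))
                 (subst (TriEdge (triangleOf k) w) (sym eq) (edge-to-neighbour (k , s′))))
               (trans (at-w j) (sym (at-w k))))
        = cong (j ,_) (punchIn-injective (corner j) s s′ (vertex-injective (triangleOf j) eq))

module SunSystem {n t r : ℕ} (T : Fin t → Triangle n) (sts : IsSTS n t T) (colour : Fin (t * 3) → Fin r)
                 (proper-at-triangles : ProperAt (Flags.flagTriangle T) colour)
                 (proper-at-points : ProperAt (Flags.flagPoint T) colour) where

  open Flags T

  point : Fin n → Fin (n + r)
  point x = x ↑ˡ r

  extra : Fin r → Fin (n + r)
  extra γ = n ↑ʳ γ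

  point≢extra : ∀ x γ → point x ≢ extra γ
  point≢extra x γ eq with () ← trans (sym (splitAt-↑ˡ n x r)) (trans (cong (splitAt n) eq) (splitAt-↑ʳ n r γ))

  corners : Fin t → Fin 3 → Fin (n + r)
  corners i = point ∘ vertex (T i)

  pendants : Fin t → Fin 3 → Fin (n + r)
  pendants i p = extra (colour (combine i p))

  pendants-injective : ∀ i → Injective _≡_ _≡_ (pendants i)
  pendants-injective i {p} {q} eq = combine-injectiveʳ i p i q (proper-at-triangles
    (trans (flagTriangle-combine i p) (sym (flagTriangle-combine i q))) (↑ʳ-injective n _ _ eq))

  point-injective : Injective _≡_ _≡_ point
  point-injective = ↑ˡ-injective r _ _

  sun-injective : ∀ i → Injective _≡_ _≡_ (corners i ++ pendants i)
  sun-injective i = ++-injective (vertex-injective (T i) ∘ point-injective) (pendants-injective i) (λ _ _ → point≢extra _ _)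

  sunOf : Fin t → Sun (n + r)
  sunOf i = sun (corners i ++ pendants i) (sun-injective i)

  sunOfView : ∀ i {x y} → SunEdge (sunOf i) x y → SunEdgeView (corners i) (pendants i) x y
  sunOfView i = sunEdgeView (sun-injective i)

  pendant-endpoints : ∀ {x y a b γ δ} → SameEdge x y (point a) (extra γ) → SameEdge x y (point b) (extra δ) →
                      a ≡ b × γ ≡ δ
  pendant-endpoints (inj₁ (x≡a , y≡γ)) (inj₁ (x≡b , y≡δ)) =
    point-injective (trans (sym x≡a) x≡b) , ↑ʳ-injective n _ _ (trans (sym y≡γ) y≡δ)
  pendant-endpoints (inj₂ (x≡γ , y≡a)) (inj₂ (x≡δ , y≡b)) =
    point-injective (trans (sym y≡a) y≡b) , ↑ʳ-injective n _ _ (trans (sym x≡γ) x≡δ)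
  pendant-endpoints (inj₁ (x≡a , _)) (inj₂ (x≡δ , _)) = ⊥-elim (point≢extra _ _ (trans (sym x≡a) x≡δ))
  pendant-endpoints (inj₂ (x≡γ , _)) (inj₁ (x≡b , _)) = ⊥-elim (point≢extra _ _ (trans (sym x≡b) x≡γ))

  pendant-not-between-points : ∀ {x y a b c γ} → x ≡ point a → y ≡ point b → ¬ SameEdge x y (point c) (extra γ)
  pendant-not-between-points _ y≡b (inj₁ (_ , y≡γ)) = point≢extra _ _ (trans (sym y≡b) y≡γ)
  pendant-not-between-points x≡a _ (inj₂ (x≡γ , _)) = point≢extra _ _ (trans (sym x≡a) x≡γ)

  same-sun : ∀ {i j x y} → SunEdgeView (corners i) (pendants i) x y → SunEdgeView (corners j) (pendants j) x y → i ≡ j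
  same-sun {i} {j} (triangle p q p≢q x≡ y≡) (triangle p′ q′ p′≢q′ x≡′ y≡′) =
    IsSTS-unique T sts (p≢q ∘ vertex-injective (T i)) (vertex-TriEdge (T i) p≢q)
      (subst₂ (TriEdge (T j)) (point-injective (trans (sym x≡′) x≡)) (point-injective (trans (sym y≡′) y≡))
        (vertex-TriEdge (T j) p′≢q′))
  same-sun (triangle _ _ _ x≡ y≡) (pendant _ e) = ⊥-elim (pendant-not-between-points x≡ y≡ e)
  same-sun (pendant _ e) (triangle _ _ _ x≡ y≡) = ⊥-elim (pendant-not-between-points x≡ y≡ e)
  same-sun {i} {j} (pendant p e) (pendant q e′) =
    let (same-point , same-colour) = pendant-endpoints e e′ in
    combine-injectiveˡ i p j q (proper-at-points
      (trans (flagPoint-combine i p) (trans same-point (sym (flagPoint-combine j q)))) same-colour)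

  extras-not-joined : ∀ i γ δ → ¬ SunEdge (sunOf i) (extra γ) (extra δ)
  extras-not-joined i γ δ e with sunOfView i e
  ... | triangle _ _ _ x≡ _ = point≢extra _ _ (sym x≡)
  ... | pendant _ (inj₁ (x≡ , _)) = point≢extra _ _ (sym x≡)
  ... | pendant _ (inj₂ (_ , y≡)) = point≢extra _ _ (sym y≡)

  triangle-in-sun : ∀ i → TriangleInSun point (T i) (sunOf i)
  triangle-in-sun i = inj₁ (inj₁ (refl , refl)) , inj₂ (inj₁ (inj₁ (refl , refl))) , inj₂ (inj₂ (inj₁ (inj₂ (refl , refl))))

  embedding : (γ δ : Fin r) → γ ≢ δ → EmbedsInPartialSunSystem n t T (n + r)
  embedding γ δ γ≢δ = point , point-injective , t , sunOf ,
    ((λ i j i≢j x y e e′ → i≢j (same-sun (sunOfView i e) (sunOfView j e′))) ,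
     extra γ , extra δ , γ≢δ ∘ ↑ʳ-injective n _ _ , λ i → extras-not-joined i γ δ) ,
    id , id , triangle-in-sun

sts-embeds : ∀ {n t r} (T : Fin t → Triangle n) → IsSTS n t T → 3 ≤ r → n ≤ suc r * 2 →
             EmbedsInPartialSunSystem n t T (n + r)
sts-embeds T sts 3≤r@(s≤s (s≤s _)) n≤ =
  let open Flags T
      (colour , proper-at-triangles , proper-at-points) =
        bipartite-edge-colouring flagTriangle flagPoint (flagTriangle-degree 3≤r) (flagPoint-degree sts n≤)
  in SunSystem.embedding T sts colour proper-at-triangles proper-at-points zero (suc zero) λ ()

[3n∸1]/2≡n+[n∸1]/2 : ∀ k → (3 * suc k ∸ 1) / 2 ≡ suc k + k / 2
[3n∸1]/2≡n+[n∸1]/2 k = begin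
  (3 * suc k ∸ 1) / 2     ≡⟨ cong (_/ 2) (3[1+k]≡k+2[1+k] k) ⟩
  (k + suc k * 2) / 2     ≡⟨ +-distrib-/-∣ʳ k (divides-refl (suc k)) ⟩
  k / 2 + suc k * 2 / 2   ≡⟨ cong (k / 2 +_) (m*n/n≡m (suc k) 2) ⟩
  k / 2 + suc k           ≡⟨ +-comm (k / 2) (suc k) ⟩
  suc k + k / 2           ∎
  where
    open ≡-Reasoning
    3[1+k]≡k+2[1+k] : ∀ k → k + (suc k + (suc k + 0)) ≡ k + suc k * 2
    3[1+k]≡k+2[1+k] = solve-∀

n≤2[1+[n∸1]/2] : ∀ k → suc k ≤ suc (k / 2) * 2
n≤2[1+[n∸1]/2] k = begin-strict
  k                 ≡⟨ m≡m%n+[m/n]*n k 2 ⟩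
  k % 2 + k / 2 * 2 <⟨ +-monoˡ-< (k / 2 * 2) (m%n<n k 2) ⟩
  2 + k / 2 * 2     ∎
  where open ≤-Reasoning

lemma2p2 : (n : ℕ) → 7 ≤ n → (t : ℕ) → (T : Fin t → Triangle n) → IsSTS n t T →
    Σ (Fin n → Fin ((3 * n ∸ 1) / 2)) λ g → Injective _≡_ _≡_ g ×
      Σ ℕ λ s → Σ (Fin s → Sun ((3 * n ∸ 1) / 2)) λ S →
        IsPartialSunSystem ((3 * n ∸ 1) / 2) s S × EmbedsInto n t ((3 * n ∸ 1) / 2) s g T S
lemma2p2 (suc k) (s≤s 6≤k) t T sts =
  subst (EmbedsInPartialSunSystem (suc k) t T) (sym ([3n∸1]/2≡n+[n∸1]/2 k))
    (sts-embeds T sts (/-monoˡ-≤ 2 6≤k) (n≤2[1+[n∸1]/2] k))
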